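{- $GK(A_m)$ admits cut-elimination: every sequent derivable in $GK(A_m)$ has a $GK(A_m)$-derivation containing no application of the rule (cut) (and such a derivation can be obtained constructively).
   Context: $\mathcal{L}_{A_m}^{\Box}$-formulas are built from a countably infinite set of variables using binary $\to$ and unary $\Box$. A sequent $\Gamma\Rightarrow\Delta$ is an ordered pair of finite multisets of formulas; $\Gamma,\Delta$ denotes multiset union, $n\Gamma$ the union of $n$ copies of $\Gamma$, $n[\varphi]$ the multiset of $n$ copies of $\varphi$, $\Box\Gamma=[\Box\varphi:\varphi\in\Gamma]$. The sequent calculus $GK(A_m)$ has rules: (ID) $\Delta\Rightarrow\Delta$ (no premises); (cut) from $\Gamma,\varphi\Rightarrow\Delta$ and $\Pi\Rightarrow\varphi,\Sigma$ infer $\Gamma,\Pi\Rightarrow\Sigma,\Delta$; (mix) from $\Gamma\Rightarrow\Delta$ and $\Pi\Rightarrow\Sigma$ infer $\Gamma,\Pi\Rightarrow\Sigma,\Delta$; (sc$_n$) ($n\ge2$) from $n\Gamma\Rightarrow n\Delta$ infer $\Gamma\Rightarrow\Delta$; ($\to\Rightarrow$) from $\Gamma,\psi\Rightarrow\varphi,\Delta$ infer $\Gamma,\varphi\to\psi\Rightarrow\Delta$; ($\Rightarrow\to$) from $\Gamma,\varphi\Rightarrow\psi,\Delta$ infer $\Gamma\Rightarrow\varphi\to\psi,\Delta$; ($\Box_n$) ($n\ge0$) from $\Gamma\Rightarrow n[\varphi]$ infer $\Box\Gamma\Rightarrow n[\Box\varphi]$. A derivation is a finite tree of sequents each node of which is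 obtained from its children by a rule. -}

module Defs where

open import Data.Nat using (ℕ; suc)
open import Data.Bool using (Bool; true; false)
open import Data.List using (List; []; _∷_; _++_; map; replicate; concat)
open import Data.Product using (_×_; _,_)
open import Relation.Binary.PropositionalEquality using (_≡_)
open import Data.List.Relation.Binary.Permutation.Propositional using (_↭_)

data Fm : Set where
  var  : ℕ → Fm
  _⇒_  : Fm → Fm → Fm
  □_   : Fm → Fm

infixr 5 _⇒_

-- Finite multisets are represented by lists, considered up to permutation (_↭_).
-- n Γ : union of n copies of Γ.
copies : ℕ → List Fm → List Fm
copies n Γ = concat (replicate n Γ)

□ₗ : List Fm → List Fm
□ₗ = map □_

record Seq : Set where
  constructor _⊢_
  field
    ant : List Fm
    cons : List Fm

infix 4 _⊢_

_≈S_ : Seq → Seq → Set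
(Γ ⊢ Δ) ≈S (Γ' ⊢ Δ') = (Γ ↭ Γ') × (Δ ↭ Δ')

-- The Bool index says whether (cut) may be used:
-- GK c s  with c = true: derivations in GK(A_m);
--         with c = false: derivations containing no application of (cut).
data GK (c : Bool) : Seq → Set where
  ID   : ∀ {Δ s} → s ≈S (Δ ⊢ Δ) → GK c s
  cut  : ∀ {Γ Δ Π Σ φ s} → c ≡ true →
         GK c ((φ ∷ Γ) ⊢ Δ) → GK c (Π ⊢ (φ ∷ Σ)) →
         s ≈S ((Γ ++ Π) ⊢ (Σ ++ Δ)) → GK c s
  mix  : ∀ {Γ Δ Π Σ s} → GK c (Γ ⊢ Δ) → GK c (Π ⊢ Σ) →
         s ≈S ((Γ ++ Π) ⊢ (Σ ++ Δ)) → GK c s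
  sc   : ∀ {Γ Δ s} (n : ℕ) → GK c (copies (suc (suc n)) Γ ⊢ copies (suc (suc n)) Δ) →
         s ≈S (Γ ⊢ Δ) → GK c s
  ⇒L   : ∀ {Γ Δ φ ψ s} → GK c ((ψ ∷ Γ) ⊢ (φ ∷ Δ)) →
         s ≈S (((φ ⇒ ψ) ∷ Γ) ⊢ Δ) → GK c s
  ⇒R   : ∀ {Γ Δ φ ψ s} → GK c ((φ ∷ Γ) ⊢ (ψ ∷ Δ)) →
         s ≈S (Γ ⊢ ((φ ⇒ ψ) ∷ Δ)) → GK c s
  □R   : ∀ {Γ φ s} (n : ℕ) → GK c (Γ ⊢ replicate n φ) →
         s ≈S (□ₗ Γ ⊢ replicate n (□ φ)) → GK c s

-- A cut is a mix followed by the cancellation of one copy of the cut formula, so it suffices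
-- that every formula φ is cancellable: a cut-free derivation of X, kφ ⊢ kφ, Y yields one of X ⊢ Y.
-- The →-rules are invertible, so decomposing all formulas into their irreducible components
-- (variables and boxed formulas) reduces this to irreducible φ in irreducible sequents.  A cut-free
-- derivation of an irreducible sequent is, up to the scaling rule, a mix of "blocks": axioms p ⊢ p
-- and instances □Γ ⊢ n□ψ of the □-rule.  A variable is cancelled by discarding its axiom blocks.
-- For □a, with a cancellable by induction, each block □Γ ⊢ n□a first cancels the copies of a it
-- has on both sides; then, after scaling everything by the number M of □a produced on the right,
-- the producers are mixed into the premisses of the blocks consuming □a on the left, where the
-- copies of a cancel.  Distributing min(M, C) producer copies, C the number of □a consumed, leaves
-- □a on one side only, and identity blocks □a ⊢ □a make up the remaining difference.

module Submission where

open import Defs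
open import Data.Bool using (true; false; if_then_else_)
open import Data.Nat as ℕ using (ℕ; zero; suc; _+_; _*_; _∸_; _≤_; _⊓_; z≤n; s≤s; s≤s⁻¹)
open import Data.Nat.Properties hiding (_≟_)
open import Algebra.Properties.CommutativeSemigroup +-commutativeSemigroup using (x∙yz≈y∙xz)
open import Data.List using (List; []; _∷_; _++_; map; replicate; concat; concatMap)
import Data.List.Properties as List
open import Data.List.Relation.Unary.All using (All; []; _∷_)
import Data.List.Relation.Unary.All.Properties as All
open import Data.List.Relation.Unary.Any using (here; there)
open import Data.List.Membership.Propositional using (_∈_)
open import Data.List.Membership.Propositional.Properties using (∈-∃++)
open import Data.List.Relation.Binary.Permutation.Propositional
  using (_↭_; prep; swap; ↭-refl; ↭-sym; ↭-trans; ↭-reflexive; module PermutationReasoning)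
import Data.List.Relation.Binary.Permutation.Propositional.Properties as ↭
open import Algebra.Solver.CommutativeMonoid (↭.++-commutativeMonoid {A = Fm})
  using (solve; _⊜_; _⊕_)
open import Data.Product using (_×_; _,_; proj₁; proj₂; Σ-syntax)
open import Data.Sum using (_⊎_; inj₁; inj₂)
open import Data.Empty using (⊥-elim)
open import Relation.Nullary using (yes; no; does)
open import Relation.Binary.Definitions using (DecidableEquality)
open import Relation.Binary.PropositionalEquality
open import Function using (_∘_; case_of_)

var-injective : ∀ {m n} → var m ≡ var n → m ≡ n
var-injective refl = refl

⇒-injective : ∀ {φ ψ φ′ ψ′} → (φ ⇒ ψ) ≡ (φ′ ⇒ ψ′) → φ ≡ φ′ × ψ ≡ ψ′
⇒-injective refl = refl , refl

□-injective : ∀ {φ ψ} → □ φ ≡ □ ψ → φ ≡ ψ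
□-injective refl = refl

_≟_ : DecidableEquality Fm
var m ≟ var n with m ℕ.≟ n
... | yes refl = yes refl
... | no m≢n   = no (m≢n ∘ var-injective)
(φ ⇒ ψ) ≟ (φ′ ⇒ ψ′) with φ ≟ φ′ | ψ ≟ ψ′
... | yes refl | yes refl = yes refl
... | no φ≢φ′  | _        = no λ e → φ≢φ′ (proj₁ (⇒-injective e))
... | yes _    | no ψ≢ψ′  = no λ e → ψ≢ψ′ (proj₂ (⇒-injective e))
(□ φ) ≟ (□ ψ) with φ ≟ ψ
... | yes refl = yes refl
... | no φ≢ψ   = no λ e → φ≢ψ (□-injective e)
var _   ≟ (_ ⇒ _) = no λ ()
var _   ≟ (□ _)   = no λ ()
(_ ⇒ _) ≟ var _   = no λ ()
(_ ⇒ _) ≟ (□ _)   = no λ ()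
(□ _)   ≟ var _   = no λ ()
(□ _)   ≟ (_ ⇒ _) = no λ ()

δ : Fm → Fm → ℕ
δ φ ψ = if does (φ ≟ ψ) then 1 else 0

δ-refl : ∀ φ → δ φ φ ≡ 1
δ-refl φ with φ ≟ φ
... | yes _   = refl
... | no φ≢φ = ⊥-elim (φ≢φ refl)

δ-≢ : ∀ {φ ψ} → φ ≢ ψ → δ φ ψ ≡ 0
δ-≢ {φ} {ψ} φ≢ψ with φ ≟ ψ
... | yes φ≡ψ = ⊥-elim (φ≢ψ φ≡ψ)
... | no _    = refl

δ-□ : ∀ φ ψ → δ (□ φ) (□ ψ) ≡ δ φ ψ
δ-□ φ ψ = case φ ≟ ψ of λ where
  (yes refl) → trans (δ-refl (□ φ)) (sym (δ-refl φ))
  (no φ≢ψ)   → trans (δ-≢ (φ≢ψ ∘ □-injective)) (sym (δ-≢ φ≢ψ))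

mult : Fm → List Fm → ℕ
mult φ []      = 0
mult φ (ψ ∷ Γ) = δ φ ψ + mult φ Γ

mult-++ : ∀ φ Γ Δ → mult φ (Γ ++ Δ) ≡ mult φ Γ + mult φ Δ
mult-++ φ []      Δ = refl
mult-++ φ (ψ ∷ Γ) Δ = trans (cong (δ φ ψ +_) (mult-++ φ Γ Δ)) (sym (+-assoc (δ φ ψ) _ _))

mult-replicate : ∀ φ n ψ → mult φ (replicate n ψ) ≡ n * δ φ ψ
mult-replicate φ zero    ψ = refl
mult-replicate φ (suc n) ψ = cong (δ φ ψ +_) (mult-replicate φ n ψ)

mult-replicate-≡ : ∀ n φ → mult φ (replicate n φ) ≡ n
mult-replicate-≡ n φ = trans (mult-replicate φ n φ) (trans (cong (n *_) (δ-refl φ)) (*-identityʳ n))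

mult-replicate-≢ : ∀ {φ ψ} n → φ ≢ ψ → mult φ (replicate n ψ) ≡ 0
mult-replicate-≢ {φ} {ψ} n φ≢ψ = trans (mult-replicate φ n ψ) (trans (cong (n *_) (δ-≢ φ≢ψ)) (*-zeroʳ n))

mult-++-replicate : ∀ φ Γ n → mult φ (Γ ++ replicate n φ) ≡ mult φ Γ + n
mult-++-replicate φ Γ n = trans (mult-++ φ Γ (replicate n φ)) (cong (mult φ Γ +_) (mult-replicate-≡ n φ))

mult-copies : ∀ φ n Γ → mult φ (copies n Γ) ≡ n * mult φ Γ
mult-copies φ zero    Γ = refl
mult-copies φ (suc n) Γ = trans (mult-++ φ Γ (copies n Γ)) (cong (mult φ Γ +_) (mult-copies φ n Γ))

mult-□ : ∀ φ Γ → mult (□ φ) (□ₗ Γ) ≡ mult φ Γ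
mult-□ φ []      = refl
mult-□ φ (ψ ∷ Γ) = cong₂ _+_ (δ-□ φ ψ) (mult-□ φ Γ)

mult>0⇒∈ : ∀ φ Γ → 1 ≤ mult φ Γ → φ ∈ Γ
mult>0⇒∈ φ (ψ ∷ Γ) h with φ ≟ ψ
... | yes refl = here refl
... | no _     = there (mult>0⇒∈ φ Γ h)

mult-↭ : ∀ φ {Γ Δ} → Γ ↭ Δ → mult φ Γ ≡ mult φ Δ
mult-↭ φ _↭_.refl         = refl
mult-↭ φ (prep ψ p)       = cong (δ φ ψ +_) (mult-↭ φ p)
mult-↭ φ (swap ψ χ p)     =
  trans (cong (λ n → δ φ ψ + (δ φ χ + n)) (mult-↭ φ p)) (x∙yz≈y∙xz (δ φ ψ) (δ φ χ) _)
mult-↭ φ (_↭_.trans p q)  = trans (mult-↭ φ p) (mult-↭ φ q)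

mult-var-□ : ∀ i Γ → mult (var i) (□ₗ Γ) ≡ 0
mult-var-□ i []      = refl
mult-var-□ i (φ ∷ Γ) = mult-var-□ i Γ

mult-reduct : ∀ B k M {Γ Γ′} → Γ′ ++ replicate k B ↭ copies M Γ → mult B Γ′ + k ≡ M * mult B Γ
mult-reduct B k M {Γ} {Γ′} e =
  trans (sym (mult-++-replicate B Γ′ k)) (trans (mult-↭ B e) (mult-copies B M Γ))

replicate-+ : ∀ {A : Set} m n (x : A) → replicate (m + n) x ≡ replicate m x ++ replicate n x
replicate-+ zero    n x = refl
replicate-+ (suc m) n x = cong (x ∷_) (replicate-+ m n x)

copies-+ : ∀ m n Γ → copies (m + n) Γ ≡ copies m Γ ++ copies n Γ
copies-+ zero    n Γ = refl
copies-+ (suc m) n Γ = trans (cong (Γ ++_) (copies-+ m n Γ)) (sym (List.++-assoc Γ (copies m Γ) (copies n Γ)))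

copies-* : ∀ m n Γ → copies (m * n) Γ ≡ copies m (copies n Γ)
copies-* zero    n Γ = refl
copies-* (suc m) n Γ = trans (copies-+ n (m * n) Γ) (cong (copies n Γ ++_) (copies-* m n Γ))

copies-replicate : ∀ n k φ → copies n (replicate k φ) ≡ replicate (n * k) φ
copies-replicate zero    k φ = refl
copies-replicate (suc n) k φ =
  trans (cong (replicate k φ ++_) (copies-replicate n k φ)) (sym (replicate-+ k (n * k) φ))

copies-[] : ∀ k → copies k [] ≡ []
copies-[] zero    = refl
copies-[] (suc k) = copies-[] k

copies-↭ : ∀ n {Γ Δ} → Γ ↭ Δ → copies n Γ ↭ copies n Δ
copies-↭ zero    p = ↭-refl
copies-↭ (suc n) p = ↭.++⁺ p (copies-↭ n p)

copies-++ : ∀ n Γ Δ → copies n (Γ ++ Δ) ↭ copies n Γ ++ copies n Δ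
copies-++ zero    Γ Δ = ↭-refl
copies-++ (suc n) Γ Δ = ↭-trans (↭.++⁺ˡ (Γ ++ Δ) (copies-++ n Γ Δ))
  (solve 4 (λ a b c d → (a ⊕ b) ⊕ (c ⊕ d) ⊜ (a ⊕ c) ⊕ (b ⊕ d)) ↭-refl
    Γ Δ (copies n Γ) (copies n Δ))

concatMap-copies : ∀ {A : Set} (f : A → List Fm) n (xs : List A) →
  concatMap f (concat (replicate n xs)) ≡ copies n (concatMap f xs)
concatMap-copies f zero    xs = refl
concatMap-copies f (suc n) xs =
  trans (List.concatMap-++ f xs _) (cong (concatMap f xs ++_) (concatMap-copies f n xs))

concatMap-replicate : ∀ {A : Set} (f : A → List Fm) k x → concatMap f (replicate k x) ≡ copies k (f x)
concatMap-replicate f zero    x = refl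
concatMap-replicate f (suc k) x = cong (f x ++_) (concatMap-replicate f k x)

□-copies : ∀ n Γ → □ₗ (copies n Γ) ≡ copies n (□ₗ Γ)
□-copies zero    Γ = refl
□-copies (suc n) Γ = trans (List.map-++ □_ Γ (copies n Γ)) (cong (□ₗ Γ ++_) (□-copies n Γ))

copies-∷ : ∀ k φ Γ → copies k (φ ∷ Γ) ↭ replicate k φ ++ copies k Γ
copies-∷ zero    φ Γ = ↭-refl
copies-∷ (suc k) φ Γ = prep φ (↭-trans (↭.++⁺ˡ Γ (copies-∷ k φ Γ)) (↭.shifts Γ (replicate k φ)))

copies-1 : ∀ Γ → Γ ↭ copies 1 Γ
copies-1 Γ = ↭-sym (↭.++-identityʳ Γ)

concatMap-↭ : ∀ {A B : Set} (f : A → List B) {xs ys} → xs ↭ ys → concatMap f xs ↭ concatMap f ys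
concatMap-↭ f _↭_.refl          = ↭-refl
concatMap-↭ f (prep x p)        = ↭.++⁺ˡ (f x) (concatMap-↭ f p)
concatMap-↭ f (swap x y p)      =
  ↭-trans (↭.shifts (f x) (f y)) (↭.++⁺ˡ (f y) (↭.++⁺ˡ (f x) (concatMap-↭ f p)))
concatMap-↭ f (_↭_.trans p q)   = ↭-trans (concatMap-↭ f p) (concatMap-↭ f q)

++-cancelˡ-↭ : ∀ {A : Set} (Θ : List A) {Γ Δ : List A} → Θ ++ Γ ↭ Θ ++ Δ → Γ ↭ Δ
++-cancelˡ-↭ []      p = p
++-cancelˡ-↭ (φ ∷ Θ) p = ++-cancelˡ-↭ Θ (↭.drop-∷ p)

++-cancelʳ-↭ : ∀ {A : Set} (Θ : List A) {Γ Δ : List A} → Γ ++ Θ ↭ Δ ++ Θ → Γ ↭ Δ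
++-cancelʳ-↭ Θ {Γ} {Δ} p = ++-cancelˡ-↭ Θ (↭-trans (↭.++-comm Θ Γ) (↭-trans p (↭.++-comm Δ Θ)))

↭-∷-replicate : ∀ {A : Set} {x : A} {Θ Θ′} c →
  Θ ↭ Θ′ ++ replicate c x → x ∷ Θ ↭ Θ′ ++ replicate (suc c) x
↭-∷-replicate {x = x} {Θ′ = Θ′} c e = ↭-trans (prep x e) (↭-sym (↭.shift x Θ′ (replicate c x)))

↭-++ˡ : ∀ {A : Set} (Λ : List A) {Θ Θ′ R} → Θ ↭ Θ′ ++ R → Λ ++ Θ ↭ (Λ ++ Θ′) ++ R
↭-++ˡ Λ {Θ′ = Θ′} {R} e = ↭-trans (↭.++⁺ˡ Λ e) (↭-sym (↭.++-assoc Λ Θ′ R))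

extract : ∀ φ j Γ → j ≤ mult φ Γ → Σ[ Γ′ ∈ List Fm ] Γ ↭ Γ′ ++ replicate j φ
extract φ zero    Γ _ = Γ , ↭-sym (↭.++-identityʳ Γ)
extract φ (suc j) Γ j<mult with ∈-∃++ (mult>0⇒∈ φ Γ (≤-trans (s≤s z≤n) j<mult))
... | Γ₁ , Γ₂ , refl with extract φ j (Γ₁ ++ Γ₂) (s≤s⁻¹ (subst (suc j ≤_) mult-shift j<mult))
  where
  mult-shift : mult φ (Γ₁ ++ φ ∷ Γ₂) ≡ suc (mult φ (Γ₁ ++ Γ₂))
  mult-shift = trans (mult-↭ φ (↭.shift φ Γ₁ Γ₂)) (cong (_+ mult φ (Γ₁ ++ Γ₂)) (δ-refl φ))
... | Γ′ , p =
  Γ′ , ↭-trans (↭.shift φ Γ₁ Γ₂) (↭-trans (prep φ p) (↭-sym (↭.shift φ Γ′ (replicate j φ))))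

m⊓n+[m∸m⊓n]⊓o≡m⊓[n+o] : ∀ m n o → m ⊓ n + (m ∸ m ⊓ n) ⊓ o ≡ m ⊓ (n + o)
m⊓n+[m∸m⊓n]⊓o≡m⊓[n+o] m n o with ≤-total m n
... | inj₁ m≤n rewrite m≤n⇒m⊓n≡m m≤n | n∸n≡0 m | m≤n⇒m⊓n≡m (≤-trans m≤n (m≤m+n n o)) =
  +-identityʳ m
... | inj₂ n≤m rewrite m≥n⇒m⊓n≡n n≤m =
  trans (+-distribˡ-⊓ n (m ∸ n) o) (cong (_⊓ (n + o)) (m+[n∸m]≡n n≤m))

gk-↭ : ∀ {c Γ Δ Γ′ Δ′} → GK c (Γ ⊢ Δ) → Γ ↭ Γ′ → Δ ↭ Δ′ → GK c (Γ′ ⊢ Δ′)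
gk-↭ {Γ = Γ} {Δ} {Γ′} {Δ′} d Γ↭Γ′ Δ↭Δ′ = retarget d
  where
  conclusion : ∀ {s} → (Γ ⊢ Δ) ≈S s → (Γ′ ⊢ Δ′) ≈S s
  conclusion {_ ⊢ _} (p , q) = ↭-trans (↭-sym Γ↭Γ′) p , ↭-trans (↭-sym Δ↭Δ′) q
  retarget : GK _ (Γ ⊢ Δ) → GK _ (Γ′ ⊢ Δ′)
  retarget (ID p)            = ID (conclusion p)
  retarget (cut c≡t d₁ d₂ p) = cut c≡t d₁ d₂ (conclusion p)
  retarget (mix d₁ d₂ p)     = mix d₁ d₂ (conclusion p)
  retarget (sc n d p)        = sc n d (conclusion p)
  retarget (⇒L d p)          = ⇒L d (conclusion p)
  retarget (⇒R d p)          = ⇒R d (conclusion p)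
  retarget (□R n d p)        = □R n d (conclusion p)

CutFree : Seq → Set
CutFree = GK false

cf-id : ∀ {Γ Δ} → Γ ↭ Δ → CutFree (Γ ⊢ Δ)
cf-id Γ↭Δ = ID (Γ↭Δ , ↭-refl)

cf-mix : ∀ {Γ₁ Δ₁ Γ₂ Δ₂} →
  CutFree (Γ₁ ⊢ Δ₁) → CutFree (Γ₂ ⊢ Δ₂) → CutFree (Γ₁ ++ Γ₂ ⊢ Δ₁ ++ Δ₂)
cf-mix {Δ₁ = Δ₁} {Δ₂ = Δ₂} d₁ d₂ = mix d₁ d₂ (↭-refl , ↭.++-comm Δ₁ Δ₂)

cf-⇒L : ∀ {Γ Δ φ ψ} → CutFree (ψ ∷ Γ ⊢ φ ∷ Δ) → CutFree ((φ ⇒ ψ) ∷ Γ ⊢ Δ)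
cf-⇒L d = ⇒L d (↭-refl , ↭-refl)

cf-⇒R : ∀ {Γ Δ φ ψ} → CutFree (φ ∷ Γ ⊢ ψ ∷ Δ) → CutFree (Γ ⊢ (φ ⇒ ψ) ∷ Δ)
cf-⇒R d = ⇒R d (↭-refl , ↭-refl)

cf-□ : ∀ {Γ φ} n → CutFree (Γ ⊢ replicate n φ) → CutFree (□ₗ Γ ⊢ replicate n (□ φ))
cf-□ n d = □R n d (↭-refl , ↭-refl)

cf-copies : ∀ n {Γ Δ} → CutFree (Γ ⊢ Δ) → CutFree (copies n Γ ⊢ copies n Δ)
cf-copies zero    d = cf-id ↭-refl
cf-copies (suc n) d = cf-mix d (cf-copies n d)

cf-sc : ∀ s {Γ Δ} → CutFree (copies (suc s) Γ ⊢ copies (suc s) Δ) → CutFree (Γ ⊢ Δ)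
cf-sc zero    {Γ} {Δ} d = gk-↭ d (↭.++-identityʳ Γ) (↭.++-identityʳ Δ)
cf-sc (suc s)         d = sc s d (↭-refl , ↭-refl)

-- φ on the left of a sequent is interderivable with pos φ on the left and neg φ on the right.
pos neg : Fm → List Fm
pos (var i) = var i ∷ []
pos (φ ⇒ ψ) = pos ψ ++ neg φ
pos (□ φ)   = □ φ ∷ []
neg (var i) = []
neg (φ ⇒ ψ) = neg ψ ++ pos φ
neg (□ φ)   = []

pos⋆ neg⋆ : List Fm → List Fm
pos⋆ = concatMap pos
neg⋆ = concatMap neg

unfold : Seq → Seq
unfold (Γ ⊢ Δ) = pos⋆ Γ ++ neg⋆ Δ ⊢ neg⋆ Γ ++ pos⋆ Δ

pos⋆-□ : ∀ Γ → pos⋆ (□ₗ Γ) ≡ □ₗ Γ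
pos⋆-□ []      = refl
pos⋆-□ (φ ∷ Γ) = cong (□ φ ∷_) (pos⋆-□ Γ)

neg⋆-□ : ∀ Γ → neg⋆ (□ₗ Γ) ≡ []
neg⋆-□ []      = refl
neg⋆-□ (φ ∷ Γ) = neg⋆-□ Γ

cf-unfold-↭ : ∀ {Γ Δ Γ′ Δ′} →
  CutFree (unfold (Γ ⊢ Δ)) → Γ ↭ Γ′ → Δ ↭ Δ′ → CutFree (unfold (Γ′ ⊢ Δ′))
cf-unfold-↭ d p q =
  gk-↭ d (↭.++⁺ (concatMap-↭ pos p) (concatMap-↭ neg q)) (↭.++⁺ (concatMap-↭ neg p) (concatMap-↭ pos q))

cf-unfold : ∀ {s} → CutFree s → CutFree (unfold s)
cf-unfold (ID {Δ} (p , q)) = cf-unfold-↭ (cf-id (↭.++-comm (pos⋆ Δ) (neg⋆ Δ))) (↭-sym p) (↭-sym q)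
cf-unfold (mix {Γ} {Δ} {Π} {Σ} d₁ d₂ (p , q)) =
  cf-unfold-↭ (gk-↭ (cf-mix (cf-unfold d₁) (cf-unfold d₂)) (regroup pos neg) (regroup neg pos))
              (↭-sym p) (↭-sym q)
  where
  regroup : ∀ f g → (concatMap f Γ ++ concatMap g Δ) ++ (concatMap f Π ++ concatMap g Σ)
                    ↭ concatMap f (Γ ++ Π) ++ concatMap g (Σ ++ Δ)
  regroup f g = ↭-trans
    (solve 4 (λ a b c d → (a ⊕ b) ⊕ (c ⊕ d) ⊜ (a ⊕ c) ⊕ (d ⊕ b)) ↭-refl
      (concatMap f Γ) (concatMap g Δ) (concatMap f Π) (concatMap g Σ))
    (↭-reflexive (sym (cong₂ _++_ (List.concatMap-++ f Γ Π) (List.concatMap-++ g Σ Δ))))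
cf-unfold (sc {Γ} {Δ} n d (p , q)) =
  cf-unfold-↭ (cf-sc (suc n) (gk-↭ (cf-unfold d) (gather pos neg) (gather neg pos))) (↭-sym p) (↭-sym q)
  where
  m = suc (suc n)
  gather : ∀ f g → concatMap f (copies m Γ) ++ concatMap g (copies m Δ)
                   ↭ copies m (concatMap f Γ ++ concatMap g Δ)
  gather f g = ↭-trans (↭-reflexive (cong₂ _++_ (concatMap-copies f m Γ) (concatMap-copies g m Δ)))
                       (↭-sym (copies-++ m (concatMap f Γ) (concatMap g Δ)))
cf-unfold (⇒L {Γ} {Δ} {φ} {ψ} d (p , q)) =
  cf-unfold-↭ (gk-↭ (cf-unfold d) (regroup pos neg) (regroup neg pos)) (↭-sym p) (↭-sym q)
  where
  regroup : ∀ f g → (f ψ ++ concatMap f Γ) ++ (g φ ++ concatMap g Δ)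
                    ↭ ((f ψ ++ g φ) ++ concatMap f Γ) ++ concatMap g Δ
  regroup f g = solve 4 (λ a b c d → (a ⊕ b) ⊕ (c ⊕ d) ⊜ ((a ⊕ c) ⊕ b) ⊕ d) ↭-refl
    (f ψ) (concatMap f Γ) (g φ) (concatMap g Δ)
cf-unfold (⇒R {Γ} {Δ} {φ} {ψ} d (p , q)) =
  cf-unfold-↭ (gk-↭ (cf-unfold d) (regroup pos neg) (regroup neg pos)) (↭-sym p) (↭-sym q)
  where
  regroup : ∀ f g → (f φ ++ concatMap f Γ) ++ (g ψ ++ concatMap g Δ)
                    ↭ concatMap f Γ ++ ((g ψ ++ f φ) ++ concatMap g Δ)
  regroup f g = solve 4 (λ a b c d → (a ⊕ b) ⊕ (c ⊕ d) ⊜ b ⊕ ((c ⊕ a) ⊕ d)) ↭-refl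
    (f φ) (concatMap f Γ) (g ψ) (concatMap g Δ)
cf-unfold (□R {Γ} {φ} n d (p , q)) = cf-unfold-↭ (gk-↭ (cf-□ n d) left right) (↭-sym p) (↭-sym q)
  where
  boxes : □ₗ (replicate n φ) ≡ replicate n (□ φ)
  boxes = List.map-replicate □_ n φ
  left : □ₗ Γ ↭ pos⋆ (□ₗ Γ) ++ neg⋆ (replicate n (□ φ))
  left = ↭-reflexive (sym (trans
    (cong₂ _++_ (pos⋆-□ Γ) (trans (cong neg⋆ (sym boxes)) (neg⋆-□ (replicate n φ))))
    (List.++-identityʳ (□ₗ Γ))))
  right : replicate n (□ φ) ↭ neg⋆ (□ₗ Γ) ++ pos⋆ (replicate n (□ φ))
  right = ↭-reflexive (sym (cong₂ _++_ (neg⋆-□ Γ)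
    (trans (cong pos⋆ (sym boxes)) (trans (pos⋆-□ (replicate n φ)) boxes))))

cf-foldˡ : ∀ φ {Γ Δ} → CutFree (pos φ ++ Γ ⊢ neg φ ++ Δ) → CutFree (φ ∷ Γ ⊢ Δ)
cf-foldʳ : ∀ φ {Γ Δ} → CutFree (neg φ ++ Γ ⊢ pos φ ++ Δ) → CutFree (Γ ⊢ φ ∷ Δ)
cf-foldˡ (var i) d = d
cf-foldˡ (□ φ)   d = d
cf-foldˡ (φ ⇒ ψ) {Γ} {Δ} d =
  cf-⇒L (cf-foldʳ φ (gk-↭ (cf-foldˡ ψ (gk-↭ d (↭.++-assoc (pos ψ) (neg φ) Γ)
                                              (↭.++-assoc (neg ψ) (pos φ) Δ)))
                          (↭-sym (↭.shift ψ (neg φ) Γ)) ↭-refl))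
cf-foldʳ (var i) d = d
cf-foldʳ (□ φ)   d = d
cf-foldʳ (φ ⇒ ψ) {Γ} {Δ} d =
  cf-⇒R (cf-foldʳ ψ (gk-↭ (cf-foldˡ φ (gk-↭ d (swap-front (neg ψ) (pos φ) Γ)
                                              (swap-front (pos ψ) (neg φ) Δ)))
                          (↭-sym (↭.shift φ (neg ψ) Γ)) ↭-refl))
  where
  swap-front : ∀ A B C → (A ++ B) ++ C ↭ B ++ (A ++ C)
  swap-front = solve 3 (λ a b c → (a ⊕ b) ⊕ c ⊜ b ⊕ (a ⊕ c)) ↭-refl

cf-fold⋆ˡ : ∀ Γ {Γ₀ Δ₀} →
  CutFree (pos⋆ Γ ++ Γ₀ ⊢ neg⋆ Γ ++ Δ₀) → CutFree (Γ ++ Γ₀ ⊢ Δ₀)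
cf-fold⋆ˡ []      d = d
cf-fold⋆ˡ (φ ∷ Γ) {Γ₀} {Δ₀} d =
  gk-↭ (cf-fold⋆ˡ Γ (gk-↭ (cf-foldˡ φ (gk-↭ d (↭.++-assoc (pos φ) (pos⋆ Γ) Γ₀)
                                              (↭.++-assoc (neg φ) (neg⋆ Γ) Δ₀)))
                          (↭-sym (↭.shift φ (pos⋆ Γ) Γ₀)) ↭-refl))
       (↭.shift φ Γ Γ₀) ↭-refl

cf-fold⋆ʳ : ∀ Δ {Γ₀ Δ₀} →
  CutFree (neg⋆ Δ ++ Γ₀ ⊢ pos⋆ Δ ++ Δ₀) → CutFree (Γ₀ ⊢ Δ ++ Δ₀)
cf-fold⋆ʳ []      d = d
cf-fold⋆ʳ (φ ∷ Δ) {Γ₀} {Δ₀} d =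
  gk-↭ (cf-fold⋆ʳ Δ (gk-↭ (cf-foldʳ φ (gk-↭ d (↭.++-assoc (neg φ) (neg⋆ Δ) Γ₀)
                                              (↭.++-assoc (pos φ) (pos⋆ Δ) Δ₀)))
                          ↭-refl (↭-sym (↭.shift φ (pos⋆ Δ) Δ₀))))
       ↭-refl (↭.shift φ Δ Δ₀)

cf-fold : ∀ {Γ Δ} → CutFree (unfold (Γ ⊢ Δ)) → CutFree (Γ ⊢ Δ)
cf-fold {Γ} {Δ} d =
  gk-↭ (cf-fold⋆ʳ Δ (gk-↭ (cf-fold⋆ˡ Γ d) (↭.++-comm Γ (neg⋆ Δ)) (↭-sym (↭.++-identityʳ (pos⋆ Δ)))))
       ↭-refl (↭.++-identityʳ Δ)

data Irreducible : Fm → Set where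
  var : ∀ i → Irreducible (var i)
  box : ∀ φ → Irreducible (□ φ)

Irreducibles : List Fm → Set
Irreducibles = All Irreducible

pos-irreducible : ∀ φ → Irreducibles (pos φ)
neg-irreducible : ∀ φ → Irreducibles (neg φ)
pos-irreducible (var i) = var i ∷ []
pos-irreducible (φ ⇒ ψ) = All.++⁺ (pos-irreducible ψ) (neg-irreducible φ)
pos-irreducible (□ φ)   = box φ ∷ []
neg-irreducible (var i) = []
neg-irreducible (φ ⇒ ψ) = All.++⁺ (neg-irreducible ψ) (pos-irreducible φ)
neg-irreducible (□ φ)   = []

concatMap-irreducible : ∀ {f : Fm → List Fm} →
  (∀ φ → Irreducibles (f φ)) → ∀ Γ → Irreducibles (concatMap f Γ)
concatMap-irreducible f-irr []      = []
concatMap-irreducible f-irr (φ ∷ Γ) = All.++⁺ (f-irr φ) (concatMap-irreducible f-irr Γ)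

copies-irreducible : ∀ n {Γ} → Irreducibles Γ → Irreducibles (copies n Γ)
copies-irreducible zero    Γ-irr = []
copies-irreducible (suc n) Γ-irr = All.++⁺ Γ-irr (copies-irreducible n Γ-irr)

replicate-irreducible : ∀ n {φ} → Irreducible φ → Irreducibles (replicate n φ)
replicate-irreducible zero    φ-irr = []
replicate-irreducible (suc n) φ-irr = φ-irr ∷ replicate-irreducible n φ-irr

Cancellable : Fm → Set
Cancellable φ = ∀ k X Y → CutFree (X ++ replicate k φ ⊢ replicate k φ ++ Y) → CutFree (X ⊢ Y)

IrreducibleCancellable : Fm → Set
IrreducibleCancellable φ = ∀ k X Y → Irreducibles X → Irreducibles Y →
  CutFree (X ++ replicate k φ ⊢ replicate k φ ++ Y) → CutFree (X ⊢ Y)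

cancel-copies : ∀ {E} → All IrreducibleCancellable E → Irreducibles E →
  ∀ k X Y → Irreducibles X → Irreducibles Y →
  CutFree (X ++ copies k E ⊢ copies k E ++ Y) → CutFree (X ⊢ Y)
cancel-copies {[]} [] [] k X Y X-irr Y-irr d =
  gk-↭ d (↭-trans (↭.++⁺ˡ X (↭-reflexive (copies-[] k))) (↭.++-identityʳ X))
         (↭-reflexive (cong (_++ Y) (copies-[] k)))
cancel-copies {φ ∷ E} (φ-canc ∷ E-canc) (φ-irr ∷ E-irr) k X Y X-irr Y-irr d =
  cancel-copies E-canc E-irr k X Y X-irr Y-irr
    (φ-canc k (X ++ copies k E) (copies k E ++ Y)
      (All.++⁺ X-irr (copies-irreducible k E-irr)) (All.++⁺ (copies-irreducible k E-irr) Y-irr)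
      (gk-↭ d left right))
  where
  left : X ++ copies k (φ ∷ E) ↭ (X ++ copies k E) ++ replicate k φ
  left = ↭-trans (↭.++⁺ˡ X (copies-∷ k φ E))
    (solve 3 (λ x a b → x ⊕ (a ⊕ b) ⊜ (x ⊕ b) ⊕ a) ↭-refl X (replicate k φ) (copies k E))
  right : copies k (φ ∷ E) ++ Y ↭ replicate k φ ++ (copies k E ++ Y)
  right = ↭-trans (↭.++⁺ʳ Y (copies-∷ k φ E)) (↭.++-assoc (replicate k φ) (copies k E) Y)

cancellable-by-parts : ∀ φ → All IrreducibleCancellable (pos φ ++ neg φ) → Cancellable φ
cancellable-by-parts φ parts-canc k X Y d =
  cf-fold (cancel-copies parts-canc (All.++⁺ (pos-irreducible φ) (neg-irreducible φ)) k
    (pos⋆ X ++ neg⋆ Y) (neg⋆ X ++ pos⋆ Y)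
    (All.++⁺ (concatMap-irreducible {pos} pos-irreducible X) (concatMap-irreducible {neg} neg-irreducible Y))
    (All.++⁺ (concatMap-irreducible {neg} neg-irreducible X) (concatMap-irreducible {pos} pos-irreducible Y))
    (gk-↭ (cf-unfold d) left right))
  where
  P = copies k (pos φ)
  N = copies k (neg φ)
  expand : ∀ f g → concatMap f (X ++ replicate k φ) ++ concatMap g (replicate k φ ++ Y)
                   ≡ (concatMap f X ++ copies k (f φ)) ++ (copies k (g φ) ++ concatMap g Y)
  expand f g = cong₂ _++_
    (trans (List.concatMap-++ f X (replicate k φ)) (cong (concatMap f X ++_) (concatMap-replicate f k φ)))
    (trans (List.concatMap-++ g (replicate k φ) Y) (cong (_++ concatMap g Y) (concatMap-replicate g k φ)))
  left : pos⋆ (X ++ replicate k φ) ++ neg⋆ (replicate k φ ++ Y)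
         ↭ (pos⋆ X ++ neg⋆ Y) ++ copies k (pos φ ++ neg φ)
  left = ↭-trans (↭-reflexive (expand pos neg)) (↭-trans
    (solve 4 (λ x p n y → (x ⊕ p) ⊕ (n ⊕ y) ⊜ (x ⊕ y) ⊕ (p ⊕ n)) ↭-refl (pos⋆ X) P N (neg⋆ Y))
    (↭.++⁺ˡ (pos⋆ X ++ neg⋆ Y) (↭-sym (copies-++ k (pos φ) (neg φ)))))
  right : neg⋆ (X ++ replicate k φ) ++ pos⋆ (replicate k φ ++ Y)
          ↭ copies k (pos φ ++ neg φ) ++ (neg⋆ X ++ pos⋆ Y)
  right = ↭-trans (↭-reflexive (expand neg pos)) (↭-trans
    (solve 4 (λ x n p y → (x ⊕ n) ⊕ (p ⊕ y) ⊜ (p ⊕ n) ⊕ (x ⊕ y)) ↭-refl (neg⋆ X) N P (pos⋆ Y))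
    (↭.++⁺ʳ (neg⋆ X ++ pos⋆ Y) (↭-sym (copies-++ k (pos φ) (neg φ)))))

data Block : Set where
  axiom : ℕ → Block
  rule  : (Γ : List Fm) (n : ℕ) (φ : Fm) → CutFree (Γ ⊢ replicate n φ) → Block

lhs rhs : Block → List Fm
lhs (axiom i)      = var i ∷ []
lhs (rule Γ n φ _) = □ₗ Γ
rhs (axiom i)      = var i ∷ []
rhs (rule Γ n φ _) = replicate n (□ φ)

lhs⋆ rhs⋆ : List Block → List Fm
lhs⋆ = concatMap lhs
rhs⋆ = concatMap rhs

cf-block : ∀ b → CutFree (lhs b ⊢ rhs b)
cf-block (axiom i)      = cf-id ↭-refl
cf-block (rule Γ n φ d) = cf-□ n d

cf-blocks : ∀ bs → CutFree (lhs⋆ bs ⊢ rhs⋆ bs)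
cf-blocks []       = cf-id ↭-refl
cf-blocks (b ∷ bs) = cf-mix (cf-block b) (cf-blocks bs)

unit : ∀ {φ} → Irreducible φ → Block
unit (var i) = axiom i
unit (box φ) = rule (φ ∷ []) 1 φ (cf-id ↭-refl)

lhs-unit : ∀ {φ} (φ-irr : Irreducible φ) → lhs (unit φ-irr) ≡ φ ∷ []
lhs-unit (var i) = refl
lhs-unit (box φ) = refl

rhs-unit : ∀ {φ} (φ-irr : Irreducible φ) → rhs (unit φ-irr) ≡ φ ∷ []
rhs-unit (var i) = refl
rhs-unit (box φ) = refl

units : ∀ {Γ} → Irreducibles Γ → List Block
units []             = []
units (φ-irr ∷ Γ-irr) = unit φ-irr ∷ units Γ-irr

lhs-units : ∀ {Γ} (Γ-irr : Irreducibles Γ) → lhs⋆ (units Γ-irr) ≡ Γ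
lhs-units []             = refl
lhs-units (φ-irr ∷ Γ-irr) = cong₂ _++_ (lhs-unit φ-irr) (lhs-units Γ-irr)

rhs-units : ∀ {Γ} (Γ-irr : Irreducibles Γ) → rhs⋆ (units Γ-irr) ≡ Γ
rhs-units []             = refl
rhs-units (φ-irr ∷ Γ-irr) = cong₂ _++_ (rhs-unit φ-irr) (rhs-units Γ-irr)

record BlockForm (Γ Δ : List Fm) : Set where
  constructor blockForm
  field
    scale  : ℕ
    blocks : List Block
    lhs↭   : lhs⋆ blocks ↭ copies (suc scale) Γ
    rhs↭   : rhs⋆ blocks ↭ copies (suc scale) Δ

blockForm⇒cf : ∀ {Γ Δ} → BlockForm Γ Δ → CutFree (Γ ⊢ Δ)
blockForm⇒cf (blockForm s bs lhs↭ rhs↭) = cf-sc s (gk-↭ (cf-blocks bs) lhs↭ rhs↭)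

concatMap-mix : ∀ (f : Block → List Fm) m n {bs₁ bs₂ Γ Δ} →
  concatMap f bs₁ ↭ copies (suc m) Γ → concatMap f bs₂ ↭ copies (suc n) Δ →
  concatMap f (concat (replicate (suc n) bs₁) ++ concat (replicate (suc m) bs₂)) ↭ copies (suc m * suc n) (Γ ++ Δ)
concatMap-mix f m n {bs₁} {bs₂} {Γ} {Δ} p q = begin
  concatMap f (concat (replicate (suc n) bs₁) ++ concat (replicate (suc m) bs₂))
    ≡⟨ trans (List.concatMap-++ f (concat (replicate (suc n) bs₁)) _)
             (cong₂ _++_ (concatMap-copies f (suc n) bs₁) (concatMap-copies f (suc m) bs₂)) ⟩
  copies (suc n) (concatMap f bs₁) ++ copies (suc m) (concatMap f bs₂)
    ↭⟨ ↭.++⁺ (copies-↭ (suc n) p) (copies-↭ (suc m) q) ⟩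
  copies (suc n) (copies (suc m) Γ) ++ copies (suc m) (copies (suc n) Δ)
    ≡⟨ sym (cong₂ _++_ (trans (cong (λ k → copies k Γ) (*-comm (suc m) (suc n))) (copies-* (suc n) (suc m) Γ))
                         (copies-* (suc m) (suc n) Δ)) ⟩
  copies (suc m * suc n) Γ ++ copies (suc m * suc n) Δ
    ↭⟨ ↭-sym (copies-++ (suc m * suc n) Γ Δ) ⟩
  copies (suc m * suc n) (Γ ++ Δ) ∎
  where open PermutationReasoning

blockForm-↭ : ∀ {Γ Δ Γ′ Δ′} → BlockForm Γ Δ → Γ ↭ Γ′ → Δ ↭ Δ′ → BlockForm Γ′ Δ′
blockForm-↭ (blockForm s bs l r) p q =
  blockForm s bs (↭-trans l (copies-↭ (suc s) p)) (↭-trans r (copies-↭ (suc s) q))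

blockForm-mix : ∀ {Γ₁ Δ₁ Γ₂ Δ₂} →
  BlockForm Γ₁ Δ₁ → BlockForm Γ₂ Δ₂ → BlockForm (Γ₁ ++ Γ₂) (Δ₁ ++ Δ₂)
blockForm-mix (blockForm s₁ bs₁ l₁ r₁) (blockForm s₂ bs₂ l₂ r₂) =
  blockForm (s₂ + s₁ * suc s₂) (concat (replicate (suc s₂) bs₁) ++ concat (replicate (suc s₁) bs₂))
    (concatMap-mix lhs s₁ s₂ {bs₁} {bs₂} l₁ l₂) (concatMap-mix rhs s₁ s₂ {bs₁} {bs₂} r₁ r₂)

blockForm-sc : ∀ n {Γ Δ} → BlockForm (copies (suc n) Γ) (copies (suc n) Δ) → BlockForm Γ Δ
blockForm-sc n {Γ} {Δ} (blockForm s bs l r) = blockForm (n + s * suc n) bs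
  (↭-trans l (↭-reflexive (sym (copies-* (suc s) (suc n) Γ))))
  (↭-trans r (↭-reflexive (sym (copies-* (suc s) (suc n) Δ))))

cf⇒blockForm : ∀ {Γ Δ} → CutFree (Γ ⊢ Δ) → Irreducibles Γ → Irreducibles Δ → BlockForm Γ Δ
cf⇒blockForm {Γ} {Δ} (ID {Δ₀} (p , q)) Γ-irr Δ-irr = blockForm 0 (units Δ₀-irr)
  (↭-trans (↭-reflexive (lhs-units Δ₀-irr)) (↭-trans (↭-sym p) (copies-1 Γ)))
  (↭-trans (↭-reflexive (rhs-units Δ₀-irr)) (↭-trans (↭-sym q) (copies-1 Δ)))
  where Δ₀-irr = ↭.All-resp-↭ p Γ-irr
cf⇒blockForm (mix {Γ₁} {Δ₁} {Π} {Σ} d₁ d₂ (p , q)) Γ-irr Δ-irr =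
  blockForm-↭ (blockForm-mix (cf⇒blockForm d₁ (proj₁ Γ₁Π-irr) (proj₂ ΣΔ₁-irr))
                             (cf⇒blockForm d₂ (proj₂ Γ₁Π-irr) (proj₁ ΣΔ₁-irr)))
              (↭-sym p) (↭-trans (↭.++-comm Δ₁ Σ) (↭-sym q))
  where
  Γ₁Π-irr = All.++⁻ Γ₁ (↭.All-resp-↭ p Γ-irr)
  ΣΔ₁-irr = All.++⁻ Σ (↭.All-resp-↭ q Δ-irr)
cf⇒blockForm (sc n d (p , q)) Γ-irr Δ-irr =
  blockForm-↭ (blockForm-sc (suc n) (cf⇒blockForm d (copies-irreducible (suc (suc n)) (↭.All-resp-↭ p Γ-irr))
                                                     (copies-irreducible (suc (suc n)) (↭.All-resp-↭ q Δ-irr))))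
              (↭-sym p) (↭-sym q)
cf⇒blockForm (⇒L d (p , q)) Γ-irr Δ-irr with ↭.All-resp-↭ p Γ-irr
... | () ∷ _
cf⇒blockForm (⇒R d (p , q)) Γ-irr Δ-irr with ↭.All-resp-↭ q Δ-irr
... | () ∷ _
cf⇒blockForm (□R {Γ₁} {φ} n d (p , q)) Γ-irr Δ-irr =
  blockForm 0 (rule Γ₁ n φ d ∷ []) (↭.++⁺ʳ [] (↭-sym p)) (↭.++⁺ʳ [] (↭-sym q))

-- The invariant maintained while B is being cancelled.
record Balanced (B : Fm) (X Y : List Fm) (bs : List Block) : Set where
  constructor balanced
  field
    scale surplus deficit : ℕ
    lhs↭ : lhs⋆ bs ++ replicate surplus B ↭ copies (suc scale) X ++ replicate deficit B
    rhs↭ : rhs⋆ bs ++ replicate surplus B ↭ copies (suc scale) Y ++ replicate deficit B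

OneSided : Fm → List Block → Set
OneSided B bs = mult B (lhs⋆ bs) ≡ 0 ⊎ mult B (rhs⋆ bs) ≡ 0

blockForm⇒balanced : ∀ {B X Y} k → BlockForm (X ++ replicate k B) (replicate k B ++ Y) →
  Σ[ bs ∈ List Block ] Balanced B X Y bs
blockForm⇒balanced {B} {X} {Y} k (blockForm s bs l r) = bs , balanced s 0 (suc s * k)
  (↭-trans (↭.++-identityʳ (lhs⋆ bs)) (↭-trans l (↭-trans (copies-++ (suc s) X (replicate k B))
    (↭-reflexive (cong (copies (suc s) X ++_) (copies-replicate (suc s) k B))))))
  (↭-trans (↭.++-identityʳ (rhs⋆ bs)) (↭-trans r (↭-trans (copies-++ (suc s) (replicate k B) Y)
    (↭-trans (↭.++-comm (copies (suc s) (replicate k B)) (copies (suc s) Y))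
      (↭-reflexive (cong (copies (suc s) Y ++_) (copies-replicate (suc s) k B)))))))

balanced⇒blockForm : ∀ {B X Y bs} → Irreducible B → Balanced B X Y bs → OneSided B bs → BlockForm X Y
balanced⇒blockForm {B} {X} {Y} {bs} B-irr (balanced s p q l r) one-sided =
  blockForm s (bs ++ replicate (p ∸ q) (unit B-irr))
    (complete lhs (lhs-unit B-irr) l)
    (complete rhs (rhs-unit B-irr) r)
  where
  bound : ∀ {Γ Θ} → mult B Γ ≡ 0 → Γ ++ replicate p B ↭ copies (suc s) Θ ++ replicate q B → q ≤ p
  bound {Γ} {Θ} free e = subst (q ≤_) count (m≤n+m q (mult B (copies (suc s) Θ)))
    where
    count : mult B (copies (suc s) Θ) + q ≡ p
    count = begin
      mult B (copies (suc s) Θ) + q                ≡⟨ sym (mult-++-replicate B (copies (suc s) Θ) q) ⟩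
      mult B (copies (suc s) Θ ++ replicate q B)  ≡⟨ sym (mult-↭ B e) ⟩
      mult B (Γ ++ replicate p B)                 ≡⟨ mult-++-replicate B Γ p ⟩
      mult B Γ + p                                ≡⟨ cong (_+ p) free ⟩
      p                                           ∎
      where open ≡-Reasoning
  q≤p : q ≤ p
  q≤p = case one-sided of λ where
    (inj₁ lhs-free) → bound lhs-free l
    (inj₂ rhs-free) → bound rhs-free r
  complete : ∀ (f : Block → List Fm) {Γ} → f (unit B-irr) ≡ B ∷ [] →
    concatMap f bs ++ replicate p B ↭ copies (suc s) Γ ++ replicate q B →
    concatMap f (bs ++ replicate (p ∸ q) (unit B-irr)) ↭ copies (suc s) Γ
  complete f {Γ} unit≡ e = ++-cancelʳ-↭ (replicate q B) (begin
    concatMap f (bs ++ replicate (p ∸ q) (unit B-irr)) ++ replicate q B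
      ≡⟨ cong (_++ replicate q B) (trans (List.concatMap-++ f bs _) (cong (concatMap f bs ++_) padding)) ⟩
    (concatMap f bs ++ replicate (p ∸ q) B) ++ replicate q B
      ≡⟨ trans (List.++-assoc (concatMap f bs) _ _) (cong (concatMap f bs ++_) (sym (replicate-+ (p ∸ q) q B))) ⟩
    concatMap f bs ++ replicate (p ∸ q + q) B
      ≡⟨ cong (λ n → concatMap f bs ++ replicate n B) (m∸n+n≡m q≤p) ⟩
    concatMap f bs ++ replicate p B
      ↭⟨ e ⟩
    copies (suc s) Γ ++ replicate q B ∎)
    where
    open PermutationReasoning
    padding : concatMap f (replicate (p ∸ q) (unit B-irr)) ≡ replicate (p ∸ q) B
    padding = trans (concatMap-replicate f (p ∸ q) (unit B-irr))
                  (trans (cong (copies (p ∸ q)) unit≡) (trans (copies-replicate (p ∸ q) 1 B)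
                                                              (cong (λ n → replicate n B) (*-identityʳ (p ∸ q)))))

record Reduct (B : Fm) (m k : ℕ) (bs bs′ : List Block) : Set where
  constructor reduct
  field
    lhs↭ : lhs⋆ bs′ ++ replicate k B ↭ copies (suc m) (lhs⋆ bs)
    rhs↭ : rhs⋆ bs′ ++ replicate k B ↭ copies (suc m) (rhs⋆ bs)

balanced-reduct : ∀ {B X Y bs bs′ m k} → Balanced B X Y bs → Reduct B m k bs bs′ → Balanced B X Y bs′
balanced-reduct {B} {X} {Y} {m = m} {k} (balanced s p q l r) (reduct l′ r′) =
  balanced (s + m * suc s) (k + suc m * p) (suc m * q) (rescale l′ l) (rescale r′ r)
  where
  rescale : ∀ {Γ Γ′ Θ} → Γ′ ++ replicate k B ↭ copies (suc m) Γ →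
    Γ ++ replicate p B ↭ copies (suc s) Θ ++ replicate q B →
    Γ′ ++ replicate (k + suc m * p) B ↭ copies (suc m * suc s) Θ ++ replicate (suc m * q) B
  rescale {Γ} {Γ′} {Θ} e′ e = begin
    Γ′ ++ replicate (k + suc m * p) B
      ≡⟨ trans (cong (Γ′ ++_) (replicate-+ k (suc m * p) B)) (sym (List.++-assoc Γ′ _ _)) ⟩
    (Γ′ ++ replicate k B) ++ replicate (suc m * p) B
      ↭⟨ ↭.++⁺ e′ (↭-reflexive (sym (copies-replicate (suc m) p B))) ⟩
    copies (suc m) Γ ++ copies (suc m) (replicate p B)
      ↭⟨ ↭-sym (copies-++ (suc m) Γ (replicate p B)) ⟩
    copies (suc m) (Γ ++ replicate p B)
      ↭⟨ copies-↭ (suc m) e ⟩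
    copies (suc m) (copies (suc s) Θ ++ replicate q B)
      ↭⟨ copies-++ (suc m) (copies (suc s) Θ) (replicate q B) ⟩
    copies (suc m) (copies (suc s) Θ) ++ copies (suc m) (replicate q B)
      ≡⟨ cong₂ _++_ (sym (copies-* (suc m) (suc s) Θ)) (copies-replicate (suc m) q B) ⟩
    copies (suc m * suc s) Θ ++ replicate (suc m * q) B ∎
    where open PermutationReasoning

irreducible-cancellable : ∀ {B} → Irreducible B →
  (∀ {X Y bs} → Balanced B X Y bs → Σ[ bs′ ∈ List Block ] Balanced B X Y bs′ × OneSided B bs′) →
  IrreducibleCancellable B
irreducible-cancellable B-irr reduce k X Y X-irr Y-irr d
  with bs , β ← blockForm⇒balanced k (cf⇒blockForm d (All.++⁺ X-irr (replicate-irreducible k B-irr))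
                                                    (All.++⁺ (replicate-irreducible k B-irr) Y-irr))
  with bs′ , β′ , one-sided ← reduce β
  = blockForm⇒cf (balanced⇒blockForm B-irr β′ one-sided)

without-axiom : ∀ i bs → Σ[ bs′ ∈ List Block ] Σ[ c ∈ ℕ ]
  (lhs⋆ bs ↭ lhs⋆ bs′ ++ replicate c (var i)) × (rhs⋆ bs ↭ rhs⋆ bs′ ++ replicate c (var i)) ×
  mult (var i) (lhs⋆ bs′) ≡ 0
without-axiom i [] = [] , 0 , ↭-refl , ↭-refl , refl
without-axiom i (axiom j ∷ bs) with i ℕ.≟ j | without-axiom i bs
... | yes refl | bs′ , c , l , r , free = bs′ , suc c , ↭-∷-replicate c l , ↭-∷-replicate c r , free
... | no i≢j   | bs′ , c , l , r , free = axiom j ∷ bs′ , c , prep (var j) l , prep (var j) r ,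
  trans (cong (_+ mult (var i) (lhs⋆ bs′)) (δ-≢ (i≢j ∘ var-injective))) free
without-axiom i (rule Γ n φ d ∷ bs) with without-axiom i bs
... | bs′ , c , l , r , free =
  rule Γ n φ d ∷ bs′ , c , ↭-++ˡ (□ₗ Γ) l , ↭-++ˡ (replicate n (□ φ)) r ,
  trans (mult-++ (var i) (□ₗ Γ) (lhs⋆ bs′)) (cong₂ _+_ (mult-var-□ i Γ) free)

irreducible-cancellable-var : ∀ i → IrreducibleCancellable (var i)
irreducible-cancellable-var i = irreducible-cancellable (var i) reduce
  where
  reduce : ∀ {X Y bs} → Balanced (var i) X Y bs →
    Σ[ bs′ ∈ List Block ] Balanced (var i) X Y bs′ × OneSided (var i) bs′
  reduce {bs = bs} β with bs′ , c , l , r , free ← without-axiom i bs =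
    bs′ , balanced-reduct {m = 0} β (reduct (↭-trans (↭-sym l) (copies-1 (lhs⋆ bs)))
                                            (↭-trans (↭-sym r) (copies-1 (rhs⋆ bs)))) ,
    inj₁ free

module _ (a : Fm) where

  record Producer : Set where
    constructor producer
    field
      context    : List Fm
      extra      : ℕ
      derivation : CutFree (context ⊢ replicate (suc extra) a)
      fresh      : mult a context ≡ 0

  producerBlock : Producer → Block
  producerBlock (producer Γ k d _) = rule Γ (suc k) a d

  Idle : Block → Set
  Idle b = mult (□ a) (rhs b) ≡ 0

  -- The blocks of a list after each □-rule block for a has cancelled the a's common to its premiss
  -- and conclusion: those still producing □a have no a left in their context.
  record Sorting (L R : List Fm) : Set where
    constructor sorting
    field
      producers : List Producer
      consumers : List Block
      idle      : All Idle consumers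
      removed   : ℕ
      lhs↭      : lhs⋆ (map producerBlock producers ++ consumers) ++ replicate removed (□ a) ↭ L
      rhs↭      : rhs⋆ (map producerBlock producers ++ consumers) ++ replicate removed (□ a) ↭ R

  sorting-++ : ∀ {L R L′ R′} → Sorting L R → Sorting L′ R′ → Sorting (L ++ L′) (R ++ R′)
  sorting-++ (sorting ps cs idle j l r) (sorting ps′ cs′ idle′ j′ l′ r′) =
    sorting (ps ++ ps′) (cs ++ cs′) (All.++⁺ idle idle′) (j + j′) (regroup lhs l l′) (regroup rhs r r′)
    where
    regroup : ∀ (f : Block → List Fm) {L L′} →
      concatMap f (map producerBlock ps ++ cs) ++ replicate j (□ a) ↭ L →
      concatMap f (map producerBlock ps′ ++ cs′) ++ replicate j′ (□ a) ↭ L′ →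
      concatMap f (map producerBlock (ps ++ ps′) ++ (cs ++ cs′)) ++ replicate (j + j′) (□ a) ↭ L ++ L′
    regroup f {L} {L′} e e′ = begin
      concatMap f (map producerBlock (ps ++ ps′) ++ (cs ++ cs′)) ++ replicate (j + j′) (□ a)
        ≡⟨ cong₂ _++_ (trans (List.concatMap-++ f (map producerBlock (ps ++ ps′)) (cs ++ cs′))
                        (cong₂ _++_ (trans (cong (concatMap f) (List.map-++ producerBlock ps ps′))
                                           (List.concatMap-++ f (map producerBlock ps) (map producerBlock ps′)))
                                    (List.concatMap-++ f cs cs′)))
                      (replicate-+ j j′ (□ a)) ⟩
      ((P ++ P′) ++ (C ++ C′)) ++ (replicate j (□ a) ++ replicate j′ (□ a))
        ↭⟨ solve 6 (λ p p′ c c′ r r′ → ((p ⊕ p′) ⊕ (c ⊕ c′)) ⊕ (r ⊕ r′) ⊜ ((p ⊕ c) ⊕ r) ⊕ ((p′ ⊕ c′) ⊕ r′))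
                   ↭-refl P P′ C C′ (replicate j (□ a)) (replicate j′ (□ a)) ⟩
      ((P ++ C) ++ replicate j (□ a)) ++ ((P′ ++ C′) ++ replicate j′ (□ a))
        ↭⟨ ↭.++⁺ (↭-trans (↭-reflexive (cong (_++ replicate j (□ a)) (sym (List.concatMap-++ f prods cs)))) e)
                 (↭-trans (↭-reflexive (cong (_++ replicate j′ (□ a)) (sym (List.concatMap-++ f prods′ cs′)))) e′) ⟩
      L ++ L′ ∎
      where
      open PermutationReasoning
      prods = map producerBlock ps
      prods′ = map producerBlock ps′
      P = concatMap f prods
      P′ = concatMap f prods′
      C = concatMap f cs
      C′ = concatMap f cs′

  sorting-[] : Sorting [] []
  sorting-[] = sorting [] [] [] 0 ↭-refl ↭-refl

  □-extracted : ∀ {Γ Γ′ j} → Γ ↭ Γ′ ++ replicate j a → (□ₗ Γ′ ++ []) ++ replicate j (□ a) ↭ □ₗ Γ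
  □-extracted {Γ} {Γ′} {j} p = begin
    (□ₗ Γ′ ++ []) ++ replicate j (□ a)  ≡⟨ cong (_++ replicate j (□ a)) (List.++-identityʳ (□ₗ Γ′)) ⟩
    □ₗ Γ′ ++ replicate j (□ a)          ≡⟨ sym (trans (List.map-++ □_ Γ′ (replicate j a))
                                                      (cong (□ₗ Γ′ ++_) (List.map-replicate □_ j a))) ⟩
    □ₗ (Γ′ ++ replicate j a)            ↭⟨ ↭.map⁺ □_ (↭-sym p) ⟩
    □ₗ Γ                                ∎
    where open PermutationReasoning

  contexts : List Producer → List Fm
  contexts = concatMap Producer.context

  yield : List Producer → ℕ
  yield []       = 0
  yield (π ∷ ps) = suc (Producer.extra π) + yield ps

  cf-producers : ∀ ps → CutFree (contexts ps ⊢ replicate (yield ps) a)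
  cf-producers []                       = cf-id ↭-refl
  cf-producers (producer Γ k d _ ∷ ps) =
    gk-↭ (cf-mix d (cf-producers ps)) ↭-refl (↭-reflexive (sym (replicate-+ (suc k) (yield ps) a)))

  lhs-producers : ∀ ps → lhs⋆ (map producerBlock ps) ≡ □ₗ (contexts ps)
  lhs-producers []                       = refl
  lhs-producers (producer Γ k d _ ∷ ps) =
    trans (cong (□ₗ Γ ++_) (lhs-producers ps)) (sym (List.map-++ □_ Γ (contexts ps)))

  rhs-producers : ∀ ps → rhs⋆ (map producerBlock ps) ≡ replicate (yield ps) (□ a)
  rhs-producers []                       = refl
  rhs-producers (producer Γ k d _ ∷ ps) =
    trans (cong (replicate (suc k) (□ a) ++_) (rhs-producers ps)) (sym (replicate-+ (suc k) (yield ps) (□ a)))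

  mult-contexts : ∀ ps → mult a (contexts ps) ≡ 0
  mult-contexts []                           = refl
  mult-contexts (producer Γ k d fresh ∷ ps) = trans (mult-++ a Γ (contexts ps)) (cong₂ _+_ fresh (mult-contexts ps))

  mult-idle : ∀ {cs} → All Idle cs → mult (□ a) (rhs⋆ cs) ≡ 0
  mult-idle {[]}     []            = refl
  mult-idle {b ∷ cs} (idle ∷ idles) = trans (mult-++ (□ a) (rhs b) (rhs⋆ cs)) (cong₂ _+_ idle (mult-idle idles))

  mult-lhs-sorted : ∀ ps cs → mult (□ a) (lhs⋆ (map producerBlock ps ++ cs)) ≡ mult (□ a) (lhs⋆ cs)
  mult-lhs-sorted ps cs = begin
    mult (□ a) (lhs⋆ (map producerBlock ps ++ cs))
      ≡⟨ cong (mult (□ a)) (List.concatMap-++ lhs (map producerBlock ps) cs) ⟩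
    mult (□ a) (lhs⋆ (map producerBlock ps) ++ lhs⋆ cs)
      ≡⟨ mult-++ (□ a) (lhs⋆ (map producerBlock ps)) (lhs⋆ cs) ⟩
    mult (□ a) (lhs⋆ (map producerBlock ps)) + mult (□ a) (lhs⋆ cs)
      ≡⟨ cong (_+ mult (□ a) (lhs⋆ cs)) (trans (cong (mult (□ a)) (lhs-producers ps))
                                               (trans (mult-□ a (contexts ps)) (mult-contexts ps))) ⟩
    mult (□ a) (lhs⋆ cs) ∎
    where open ≡-Reasoning

  mult-rhs-sorted : ∀ ps {cs} → All Idle cs → mult (□ a) (rhs⋆ (map producerBlock ps ++ cs)) ≡ yield ps
  mult-rhs-sorted ps {cs} idle = begin
    mult (□ a) (rhs⋆ (map producerBlock ps ++ cs))
      ≡⟨ cong (mult (□ a)) (List.concatMap-++ rhs (map producerBlock ps) cs) ⟩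
    mult (□ a) (rhs⋆ (map producerBlock ps) ++ rhs⋆ cs)
      ≡⟨ mult-++ (□ a) (rhs⋆ (map producerBlock ps)) (rhs⋆ cs) ⟩
    mult (□ a) (rhs⋆ (map producerBlock ps)) + mult (□ a) (rhs⋆ cs)
      ≡⟨ cong₂ _+_ (trans (cong (mult (□ a)) (rhs-producers ps)) (mult-replicate-≡ (yield ps) (□ a)))
                   (mult-idle idle) ⟩
    yield ps + 0
      ≡⟨ +-identityʳ (yield ps) ⟩
    yield ps ∎
    where open ≡-Reasoning

  module _ (a-canc : Cancellable a) where

    sort-rule : ∀ Γ n → CutFree (Γ ⊢ replicate n a) → Sorting (□ₗ Γ) (replicate n (□ a))
    sort-rule Γ n d with n ≤? mult a Γ
    ... | yes n≤c with Γ′ , p ← extract a n Γ n≤c =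
      sorting [] (rule Γ′ 0 a d′ ∷ []) (refl ∷ []) n (□-extracted {Γ′ = Γ′} p) ↭-refl
      where d′ = a-canc n Γ′ [] (gk-↭ d p (↭-sym (↭.++-identityʳ (replicate n a))))
    ... | no n≰c with k , c+k≡n ← m≤n⇒∃[o]m+o≡n (≰⇒> n≰c) | Γ′ , p ← extract a (mult a Γ) Γ ≤-refl =
      sorting (producer Γ′ k d′ fresh ∷ []) [] [] c (□-extracted {Γ′ = Γ′} p) right
      where
      c = mult a Γ
      n≡c+[1+k] : n ≡ c + suc k
      n≡c+[1+k] = trans (sym c+k≡n) (sym (+-suc c k))
      d′ = a-canc c Γ′ (replicate (suc k) a)
             (gk-↭ d p (↭-reflexive (trans (cong (λ m → replicate m a) n≡c+[1+k]) (replicate-+ c (suc k) a))))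
      fresh : mult a Γ′ ≡ 0
      fresh = +-cancelʳ-≡ c _ 0 (sym (trans (mult-↭ a p) (mult-++-replicate a Γ′ c)))
      right : (replicate (suc k) (□ a) ++ []) ++ replicate c (□ a) ↭ replicate n (□ a)
      right = begin
        (replicate (suc k) (□ a) ++ []) ++ replicate c (□ a)
          ↭⟨ ↭.++⁺ʳ _ (↭.++-identityʳ (replicate (suc k) (□ a))) ⟩
        replicate (suc k) (□ a) ++ replicate c (□ a)
          ↭⟨ ↭.++-comm (replicate (suc k) (□ a)) _ ⟩
        replicate c (□ a) ++ replicate (suc k) (□ a)
          ≡⟨ sym (trans (cong (λ m → replicate m (□ a)) n≡c+[1+k]) (replicate-+ c (suc k) (□ a))) ⟩
        replicate n (□ a) ∎
        where open PermutationReasoning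

    sort-block : ∀ b → Sorting (lhs b) (rhs b)
    sort-block (axiom i) = sorting [] (axiom i ∷ []) (refl ∷ []) 0 ↭-refl ↭-refl
    sort-block (rule Γ n φ d) with φ ≟ a
    ... | yes refl = sort-rule Γ n d
    ... | no φ≢a   = sorting [] (rule Γ n φ d ∷ []) (idle ∷ []) 0 (unpad (□ₗ Γ)) (unpad (replicate n (□ φ)))
      where
      idle = mult-replicate-≢ n (λ □a≡□φ → φ≢a (sym (□-injective □a≡□φ)))
      unpad : ∀ L → (L ++ []) ++ [] ↭ L
      unpad L = ↭-reflexive (trans (List.++-identityʳ (L ++ [])) (List.++-identityʳ L))

    sort : ∀ bs → Sorting (lhs⋆ bs) (rhs⋆ bs)
    sort []       = sorting-[]
    sort (b ∷ bs) = sorting-++ (sort-block b) (sort bs)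

    module _ (M : ℕ) (G : List Fm) (dG : CutFree (G ⊢ replicate M a)) where

      record Absorbed (L R : List Fm) (u : ℕ) : Set where
        constructor absorbed
        field
          result : List Block
          lhs↭   : lhs⋆ result ++ replicate (u * M) (□ a) ↭ copies M L ++ copies u (□ₗ G)
          rhs↭   : rhs⋆ result ↭ copies M R

      absorb-bound : ∀ {u} Γ → u ≤ mult a Γ → u * M ≤ mult a (copies M Γ ++ copies u G)
      absorb-bound {u} Γ u≤c = begin
        u * M                                         ≡⟨ *-comm u M ⟩
        M * u                                         ≤⟨ *-monoʳ-≤ M u≤c ⟩
        M * mult a Γ                                  ≡⟨ sym (mult-copies a M Γ) ⟩
        mult a (copies M Γ)                           ≤⟨ m≤m+n _ _ ⟩
        mult a (copies M Γ) + mult a (copies u G)     ≡⟨ sym (mult-++ a (copies M Γ) (copies u G)) ⟩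
        mult a (copies M Γ ++ copies u G)             ∎
        where open ≤-Reasoning

      -- M copies of the block's premiss are mixed with u copies of the producers' G ⊢ M·a, and the
      -- u·M copies of a so produced cancel against copies of a in the premiss.
      absorb : ∀ b u → u ≤ mult (□ a) (lhs b) → Absorbed (lhs b) (rhs b) u
      absorb (axiom i) .0 z≤n = absorbed (replicate M (axiom i))
        (↭-reflexive (cong (_++ []) (concatMap-replicate lhs M (axiom i))))
        (↭-reflexive (concatMap-replicate rhs M (axiom i)))
      absorb (rule Γ n φ d) u u≤
        with Γ′ , p ← extract a (u * M) (copies M Γ ++ copies u G)
                              (absorb-bound Γ (subst (u ≤_) (mult-□ a Γ) u≤)) =
        absorbed (rule Γ′ (M * n) φ d′ ∷ []) left right
        where
        goals : copies M (replicate n φ) ++ copies u (replicate M a) ↭ replicate (u * M) a ++ replicate (M * n) φ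
        goals = ↭-trans (↭-reflexive (cong₂ _++_ (copies-replicate M n φ) (copies-replicate u M a)))
                        (↭.++-comm (replicate (M * n) φ) _)
        d′ = a-canc (u * M) Γ′ (replicate (M * n) φ) (gk-↭ (cf-mix (cf-copies M d) (cf-copies u dG)) p goals)
        left : (□ₗ Γ′ ++ []) ++ replicate (u * M) (□ a) ↭ copies M (□ₗ Γ) ++ copies u (□ₗ G)
        left = ↭-trans (□-extracted {Γ′ = Γ′} p)
          (↭-reflexive (trans (List.map-++ □_ (copies M Γ) (copies u G))
                              (cong₂ _++_ (□-copies M Γ) (□-copies u G))))
        right : replicate (M * n) (□ φ) ++ [] ↭ copies M (replicate n (□ φ))
        right = ↭-trans (↭.++-identityʳ _) (↭-reflexive (sym (copies-replicate M n (□ φ))))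

      absorbed-++ : ∀ {L R L′ R′ u u′} →
        Absorbed L R u → Absorbed L′ R′ u′ → Absorbed (L ++ L′) (R ++ R′) (u + u′)
      absorbed-++ {L} {R} {L′} {R′} {u} {u′} (absorbed res l r) (absorbed res′ l′ r′) =
        absorbed (res ++ res′) left
          (↭-trans (↭-reflexive (List.concatMap-++ rhs res res′))
                   (↭-trans (↭.++⁺ r r′) (↭-sym (copies-++ M R R′))))
        where
        open PermutationReasoning
        B = □ a
        left : lhs⋆ (res ++ res′) ++ replicate ((u + u′) * M) B
               ↭ copies M (L ++ L′) ++ copies (u + u′) (□ₗ G)
        left = begin
          lhs⋆ (res ++ res′) ++ replicate ((u + u′) * M) B
            ≡⟨ cong₂ _++_ (List.concatMap-++ lhs res res′)
                          (trans (cong (λ k → replicate k B) (*-distribʳ-+ M u u′))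
                                 (replicate-+ (u * M) (u′ * M) B)) ⟩
          (lhs⋆ res ++ lhs⋆ res′) ++ (replicate (u * M) B ++ replicate (u′ * M) B)
            ↭⟨ solve 4 (λ x x′ y y′ → (x ⊕ x′) ⊕ (y ⊕ y′) ⊜ (x ⊕ y) ⊕ (x′ ⊕ y′)) ↭-refl
                 (lhs⋆ res) (lhs⋆ res′) (replicate (u * M) B) (replicate (u′ * M) B) ⟩
          (lhs⋆ res ++ replicate (u * M) B) ++ (lhs⋆ res′ ++ replicate (u′ * M) B)
            ↭⟨ ↭.++⁺ l l′ ⟩
          (copies M L ++ copies u (□ₗ G)) ++ (copies M L′ ++ copies u′ (□ₗ G))
            ↭⟨ solve 4 (λ x y x′ y′ → (x ⊕ y) ⊕ (x′ ⊕ y′) ⊜ (x ⊕ x′) ⊕ (y ⊕ y′)) ↭-refl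
                 (copies M L) (copies u (□ₗ G)) (copies M L′) (copies u′ (□ₗ G)) ⟩
          (copies M L ++ copies M L′) ++ (copies u (□ₗ G) ++ copies u′ (□ₗ G))
            ↭⟨ ↭.++⁺ (↭-sym (copies-++ M L L′)) (↭-reflexive (sym (copies-+ u u′ (□ₗ G)))) ⟩
          copies M (L ++ L′) ++ copies (u + u′) (□ₗ G) ∎

      absorbed-[] : Absorbed [] [] 0
      absorbed-[] =
        absorbed [] (↭-reflexive (cong (_++ []) (sym (copies-[] M)))) (↭-reflexive (sym (copies-[] M)))

      absorb-all : ∀ β cs → Absorbed (lhs⋆ cs) (rhs⋆ cs) (β ⊓ mult (□ a) (lhs⋆ cs))
      absorb-all β []       = subst (Absorbed [] []) (sym (⊓-zeroʳ β)) absorbed-[]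
      absorb-all β (b ∷ cs) = subst (Absorbed (lhs b ++ lhs⋆ cs) (rhs b ++ rhs⋆ cs)) greedy
        (absorbed-++ (absorb b u (m⊓n≤n β (mult (□ a) (lhs b)))) (absorb-all (β ∸ u) cs))
        where
        u = β ⊓ mult (□ a) (lhs b)
        greedy : u + (β ∸ u) ⊓ mult (□ a) (lhs⋆ cs) ≡ β ⊓ mult (□ a) (lhs b ++ lhs⋆ cs)
        greedy = trans (m⊓n+[m∸m⊓n]⊓o≡m⊓[n+o] β _ _)
                       (cong (β ⊓_) (sym (mult-++ (□ a) (lhs b) (lhs⋆ cs))))

    merge : ∀ ps cs → All Idle cs → ∀ m → yield ps ≡ suc m →
      Σ[ k ∈ ℕ ] Σ[ bs′ ∈ List Block ] Reduct (□ a) m k (map producerBlock ps ++ cs) bs′ × OneSided (□ a) bs′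
    merge ps cs idle m yield≡ =
      U * M , merged , reduct (regroup lhs (lhs-producers ps) lhs↭) (regroup rhs rhs-ps rhs′) , one-sided
      where
      M = suc m
      B = □ a
      G = contexts ps
      C = mult B (lhs⋆ cs)
      U = M ⊓ C
      R = M ∸ U
      open Absorbed (absorb-all M G (subst (λ n → CutFree (G ⊢ replicate n a)) yield≡ (cf-producers ps)) M cs)
      prods = map producerBlock ps
      merged = concat (replicate R prods) ++ result

      rhs-ps : rhs⋆ (map producerBlock ps) ≡ replicate M B
      rhs-ps = trans (rhs-producers ps) (cong (λ n → replicate n B) yield≡)
      rhs′ : rhs⋆ result ++ replicate (U * M) B ↭ copies M (rhs⋆ cs) ++ copies U (replicate M B)
      rhs′ = ↭.++⁺ rhs↭ (↭-reflexive (sym (copies-replicate U M B)))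

      regroup : ∀ (f : Block → List Fm) {X} → concatMap f (map producerBlock ps) ≡ X →
        concatMap f result ++ replicate (U * M) B ↭ copies M (concatMap f cs) ++ copies U X →
        concatMap f merged ++ replicate (U * M) B ↭ copies M (concatMap f (map producerBlock ps ++ cs))
      regroup f {X} X≡ e = begin
        concatMap f merged ++ replicate (U * M) B
          ≡⟨ cong (_++ replicate (U * M) B) (trans (List.concatMap-++ f (concat (replicate R prods)) result)
               (cong (_++ concatMap f result) (trans (concatMap-copies f R prods) (cong (copies R) X≡)))) ⟩
        (copies R X ++ concatMap f result) ++ replicate (U * M) B
          ↭⟨ ↭.++-assoc (copies R X) (concatMap f result) _ ⟩
        copies R X ++ (concatMap f result ++ replicate (U * M) B)
          ↭⟨ ↭.++⁺ˡ (copies R X) e ⟩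
        copies R X ++ (copies M (concatMap f cs) ++ copies U X)
          ↭⟨ solve 3 (λ r y u → r ⊕ (y ⊕ u) ⊜ (u ⊕ r) ⊕ y) ↭-refl
               (copies R X) (copies M (concatMap f cs)) (copies U X) ⟩
        (copies U X ++ copies R X) ++ copies M (concatMap f cs)
          ≡⟨ cong (_++ copies M (concatMap f cs))
                  (trans (sym (copies-+ U R X)) (cong (λ n → copies n X) (m+[n∸m]≡n (m⊓n≤m M C)))) ⟩
        copies M X ++ copies M (concatMap f cs)
          ↭⟨ ↭-sym (copies-++ M X (concatMap f cs)) ⟩
        copies M (X ++ concatMap f cs)
          ≡⟨ cong (copies M) (sym (trans (List.concatMap-++ f prods cs) (cong (_++ concatMap f cs) X≡))) ⟩
        copies M (concatMap f (map producerBlock ps ++ cs)) ∎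
        where open PermutationReasoning

      lhs-count : mult B (lhs⋆ merged) + U * M ≡ M * C
      lhs-count = trans (mult-reduct B (U * M) M (regroup lhs (lhs-producers ps) lhs↭))
                        (cong (M *_) (mult-lhs-sorted ps cs))

      rhs-count : mult B (rhs⋆ merged) + U * M ≡ M * M
      rhs-count = trans (mult-reduct B (U * M) M (regroup rhs rhs-ps rhs′))
                        (cong (M *_) (trans (mult-rhs-sorted ps idle) yield≡))

      -- With U = M ⊓ C, either every consumed □a was absorbed or no producer copy is left over.
      one-sided : OneSided B merged
      one-sided with ≤-total C M
      ... | inj₁ C≤M = inj₁ (+-cancelʳ-≡ (U * M) _ 0 (trans lhs-count
                               (trans (*-comm M C) (cong (_* M) (sym (m≥n⇒m⊓n≡n C≤M))))))
      ... | inj₂ M≤C = inj₂ (+-cancelʳ-≡ (U * M) _ 0 (trans rhs-count (cong (_* M) (sym (m≤n⇒m⊓n≡m M≤C)))))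

    irreducible-cancellable-□ : IrreducibleCancellable (□ a)
    irreducible-cancellable-□ = irreducible-cancellable (box a) reduce
      where
      reduce : ∀ {X Y bs} → Balanced (□ a) X Y bs →
        Σ[ bs′ ∈ List Block ] Balanced (□ a) X Y bs′ × OneSided (□ a) bs′
      reduce {X} {Y} {bs} β with sorting ps cs idle j l r ← sort bs =
        separate (balanced-reduct {m = 0} β self-cancelled)
        where
        self-cancelled : Reduct (□ a) 0 j bs (map producerBlock ps ++ cs)
        self-cancelled = reduct (↭-trans l (copies-1 (lhs⋆ bs))) (↭-trans r (copies-1 (rhs⋆ bs)))
        separate : Balanced (□ a) X Y (map producerBlock ps ++ cs) →
          Σ[ bs′ ∈ List Block ] Balanced (□ a) X Y bs′ × OneSided (□ a) bs′
        separate β′ with yield ps in yield≡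
        ... | zero  = map producerBlock ps ++ cs , β′ , inj₂ (trans (mult-rhs-sorted ps idle) yield≡)
        ... | suc m with k , bs′ , merged , one-sided ← merge ps cs idle m yield≡ =
          bs′ , balanced-reduct β′ merged , one-sided

parts-cancellable : ∀ φ → All IrreducibleCancellable (pos φ ++ neg φ)
cancellable : ∀ φ → Cancellable φ
parts-cancellable (var i) = irreducible-cancellable-var i ∷ []
parts-cancellable (□ φ)   = irreducible-cancellable-□ φ (cancellable φ) ∷ []
parts-cancellable (φ ⇒ ψ) = ↭.All-resp-↭
  (solve 4 (λ pφ nφ pψ nψ → (pφ ⊕ nφ) ⊕ (pψ ⊕ nψ) ⊜ (pψ ⊕ nφ) ⊕ (nψ ⊕ pφ)) ↭-refl
    (pos φ) (neg φ) (pos ψ) (neg ψ))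
  (All.++⁺ (parts-cancellable φ) (parts-cancellable ψ))
cancellable φ = cancellable-by-parts φ (parts-cancellable φ)

cut-elimination : ∀ {s} → GK true s → CutFree s
cut-elimination (ID p)         = ID p
cut-elimination (cut {Γ} {Δ} {Π} {Σ} {φ} _ d₁ d₂ (p , q)) =
  gk-↭ (cancellable φ 1 (Γ ++ Π) (Σ ++ Δ)
         (gk-↭ (cf-mix (cut-elimination d₁) (cut-elimination d₂))
               (↭.++-comm (φ ∷ []) (Γ ++ Π)) (↭.++-comm Δ (φ ∷ Σ))))
       (↭-sym p) (↭-sym q)
cut-elimination (mix d₁ d₂ p) = mix (cut-elimination d₁) (cut-elimination d₂) p
cut-elimination (sc n d p)    = sc n (cut-elimination d) p
cut-elimination (⇒L d p)      = ⇒L (cut-elimination d) p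
cut-elimination (⇒R d p)      = ⇒R (cut-elimination d) p
cut-elimination (□R n d p)    = □R n (cut-elimination d) p

theorem4p6 : ∀ (s : Seq) → GK true s → GK false s
theorem4p6 s = cut-elimination
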